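{- Let $n>2$ be an integer and $r\ge1$ an integer with $2^r+1<2^n$, let $s_i=(2^r+1)2^{n+i}+1$ for $i\in\mathbb{N}$, and let $S=P_{2^r+1}(n)$. Then the set of maximal elements of $\mathrm{Ap}(S,s_0)$ with respect to $\le_S$ is $$\{2s_i+s_{i+1}+\dots+s_{n+r-1}\mid 1\le i\le r\}\cup\{2s_j+s_{j+1}+\dots+s_{n-1}+s_{n+r}\mid 1\le j\le n-2\}\cup\{2s_1+s_n+s_{n+r}\}.$$
   Context: $P_{2^r+1}(n)$ is the numerical semigroup consisting of all finite non-negative integer linear combinations of $\{(2^r+1)2^{n+i}+1\mid i\in\mathbb{N}\}$. For nonzero $m\in S$, $\mathrm{Ap}(S,m)=\{s\in S\mid s-m\notin S\}$. The order $\le_S$ on $\mathbb{Z}$ is defined by $a\le_S b$ iff $b-a\in S$. -}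

module Defs where

open import Data.Nat using (ℕ; zero; suc; _+_; _*_; _∸_; _^_; _≤_; _<_)
open import Data.Product using (Σ; _×_; _,_)
open import Data.Sum using (_⊎_)
open import Relation.Nullary using (¬_)
open import Relation.Binary.PropositionalEquality using (_≡_)

gen : ℕ → ℕ → ℕ → ℕ
gen n r i = (2 ^ r + 1) * 2 ^ (n + i) + 1

data InP (n r : ℕ) : ℕ → Set where
  P-zero : InP n r 0
  P-add  : ∀ i {x} → InP n r x → InP n r (gen n r i + x)

_≤[_,_]_ : ℕ → ℕ → ℕ → ℕ → Set
a ≤[ n , r ] b = Σ ℕ λ c → InP n r c × a + c ≡ b

InAp : ℕ → ℕ → ℕ → ℕ → Set
InAp n r m x = InP n r x × ¬ (Σ ℕ λ y → InP n r y × y + m ≡ x)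

MaxAp : ℕ → ℕ → ℕ → ℕ → Set
MaxAp n r m x = InAp n r m x × (∀ y → InAp n r m y → x ≤[ n , r ] y → y ≡ x)

sumGen : ℕ → ℕ → ℕ → ℕ → ℕ
sumGen n r a zero = 0
sumGen n r a (suc len) = gen n r a + sumGen n r (suc a) len

InTarget : ℕ → ℕ → ℕ → Set
InTarget n r x =
    (Σ ℕ λ i → 1 ≤ i × i ≤ r ×
       x ≡ 2 * gen n r i + sumGen n r (suc i) ((n + r) ∸ (suc i)))
  ⊎ ((Σ ℕ λ j → 1 ≤ j × j ≤ n ∸ 2 ×
       x ≡ 2 * gen n r j + sumGen n r (suc j) (n ∸ suc j) + gen n r (n + r))
  ⊎ x ≡ 2 * gen n r 1 + gen n r n + gen n r (n + r))

-- Write N = n + r and M = (2^r + 1) 2^n = 2^N + 2^n. Since s e = M 2^e + 1, the elements of S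
-- are exactly the numbers M a + t with a a sum of t powers of two, i.e. popcount a ≤ t ≤ a, and
-- both x - s 0 ∈ S and ≤_S become statements about binary expansions. Splitting off s 0 shows
-- that an element M a + t (a ≥ 1) of Ap(S, s 0) satisfies t < popcount a + ν₂ a and a ≤ M + t,
-- and uses only s 0, …, s N. Comparing a with 2^N and 2^N + 2^n and using
-- popcount d + popcount (2^m - d) + ν₂ d = m + 1 then places it ≤_S below one of the listed
-- elements. Conversely each listed element lies in Ap, while adding any generator to it leaves Ap.
module Submission where

open import Defs
open import Data.Nat using (ℕ; _+_; _^_; _≤_; _<_)
open import Data.Product using (_×_)

open import Data.Bool using (Bool; true; false)
open import Data.Empty using (⊥-elim)
open import Data.List using (List; []; _∷_)
open import Data.Nat using (zero; suc; _*_; _∸_; z≤n; s≤s; _≤?_; _<?_)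
open import Data.Nat.Induction using (<-rec)
open import Data.Nat.Properties
open import Data.Nat.Tactic.RingSolver using (solve-∀)
open import Data.Product using (Σ; _,_; proj₁)
open import Data.Sum using (inj₁; inj₂)
open import Relation.Binary.Definitions using (tri<; tri≈; tri>)
open import Relation.Binary.PropositionalEquality
open import Relation.Nullary using (¬_; yes; no; contradiction)

2^-suc : ∀ m → 2 ^ suc m ≡ 2 ^ m + 2 ^ m
2^-suc m = cong (2 ^ m +_) (+-identityʳ _)

1≤2^ : ∀ m → 1 ≤ 2 ^ m
1≤2^ = m^n>0 2

n<2^n : ∀ n → n < 2 ^ n
n<2^n zero    = s≤s z≤n
n<2^n (suc n) = subst₂ _≤_ (+-comm (suc n) 1) (sym (2^-suc n)) (+-mono-≤ (n<2^n n) (1≤2^ n))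

2^-cancel-≤ : ∀ {x m} → 2 ^ x ≤ 2 ^ m → x ≤ m
2^-cancel-≤ {x} {m} le with x ≤? m
... | yes x≤m = x≤m
... | no  x≰m = contradiction le (<⇒≱ (^-monoʳ-< 2 (s≤s (s≤s z≤n)) (≰⇒> x≰m)))

m+m+2≤2^m : ∀ m → 2 < m → m + m + 2 ≤ 2 ^ m
m+m+2≤2^m (suc (suc (suc zero)))    _ = ≤-refl
m+m+2≤2^m (suc (suc zero))       (s≤s (s≤s ()))
m+m+2≤2^m (suc zero)             (s≤s ())
m+m+2≤2^m (suc (suc (suc (suc k)))) _ = begin
  4 + k + (4 + k) + 2           ≡⟨ shift k ⟩
  (3 + k + (3 + k) + 2) + 2     ≤⟨ +-mono-≤ (m+m+2≤2^m (suc (suc (suc k))) (s≤s (s≤s (s≤s z≤n))))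
                                            (^-monoʳ-≤ 2 {1} {3 + k} (s≤s z≤n)) ⟩
  2 ^ (3 + k) + 2 ^ (3 + k)     ≡⟨ 2^-suc (3 + k) ⟨
  2 ^ (4 + k)                   ∎
  where
  open ≤-Reasoning
  shift : ∀ k → 4 + k + (4 + k) + 2 ≡ (3 + k + (3 + k) + 2) + 2
  shift = solve-∀

2^≤2*suc⇒≤3 : ∀ s → 2 ^ s ≤ 2 * suc s → s ≤ 3
2^≤2*suc⇒≤3 s 2^s≤ with s ≤? 3
... | yes s≤3 = s≤3
... | no  s≰3 = contradiction 2^s≤ (<⇒≱ (go s (≰⇒> s≰3)))
  where
  go : ∀ s → 3 < s → 2 * suc s < 2 ^ s
  go (suc s') (s≤s 2<s') = begin-strict
    2 * suc (suc s')                  <⟨ m<m+n _ (≤-trans (≤-trans (s≤s z≤n) 2<s') (m≤m+n s' s')) ⟩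
    2 * suc (suc s') + (s' + s')      ≡⟨ regroup s' ⟩
    (s' + s' + 2) + (s' + s' + 2)     ≤⟨ +-mono-≤ (m+m+2≤2^m s' 2<s') (m+m+2≤2^m s' 2<s') ⟩
    2 ^ s' + 2 ^ s'                   ≡⟨ 2^-suc s' ⟨
    2 ^ suc s'                        ∎
    where
    open ≤-Reasoning
    regroup : ∀ s → 2 * suc (suc s) + (s + s) ≡ (s + s + 2) + (s + s + 2)
    regroup = solve-∀

2^+≤2^[+] : ∀ a b → 2 ^ a + b ≤ 2 ^ (a + b)
2^+≤2^[+] a zero    = ≤-reflexive (trans (+-identityʳ _) (cong (2 ^_) (sym (+-identityʳ a))))
2^+≤2^[+] a (suc b) = begin
  2 ^ a + suc b               ≡⟨ +-suc (2 ^ a) b ⟩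
  suc (2 ^ a + b)             ≤⟨ s≤s (2^+≤2^[+] a b) ⟩
  suc (2 ^ (a + b))           ≤⟨ +-monoˡ-≤ (2 ^ (a + b)) (1≤2^ (a + b)) ⟩
  2 ^ (a + b) + 2 ^ (a + b)   ≡⟨ 2^-suc (a + b) ⟨
  2 ^ suc (a + b)             ≡⟨ cong (2 ^_) (+-suc a b) ⟨
  2 ^ (a + suc b)             ∎
  where open ≤-Reasoning

double-+ : ∀ x y → (x + x) + (y + y) ≡ (x + y) + (x + y)
double-+ = solve-∀

odd-+-odd : ∀ x y → suc (x + x) + suc (y + y) ≡ (suc x + y) + (suc x + y)
odd-+-odd = solve-∀

double-+-odd : ∀ x y → (x + x) + suc (y + y) ≡ suc ((x + y) + (x + y))
double-+-odd = solve-∀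

odd-+-double : ∀ x y → suc (x + x) + (y + y) ≡ suc ((x + y) + (x + y))
odd-+-double = solve-∀

2^suc+double : ∀ e q → 2 ^ suc e + (q + q) ≡ (2 ^ e + q) + (2 ^ e + q)
2^suc+double e q = trans (cong (_+ (q + q)) (2^-suc e)) (double-+ (2 ^ e) q)

2^suc+odd : ∀ e q → 2 ^ suc e + suc (q + q) ≡ suc ((2 ^ e + q) + (2 ^ e + q))
2^suc+odd e q = trans (+-suc (2 ^ suc e) (q + q)) (cong suc (2^suc+double e q))

2^+≡suc : ∀ i {b} A → suc b ≡ 2 ^ i → 2 ^ i + A ≡ suc (A + b)
2^+≡suc i {b} A suc-b≡2^i = trans (cong (_+ A) (sym suc-b≡2^i)) (cong suc (+-comm b A))

double-injective : ∀ x y → x + x ≡ y + y → x ≡ y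
double-injective zero    zero    _  = refl
double-injective (suc x) (suc y) eq rewrite +-suc x x | +-suc y y =
  cong suc (double-injective x y (suc-injective (suc-injective eq)))

odd≢double : ∀ x y → suc (x + x) ≢ y + y
odd≢double zero    (suc y) eq rewrite +-suc y y = 0≢1+n (suc-injective eq)
odd≢double (suc x) (suc y) eq rewrite +-suc x x | +-suc y y =
  odd≢double x y (suc-injective (suc-injective eq))

odd≢2^suc : ∀ m x → suc (x + x) ≢ 2 ^ suc m
odd≢2^suc m x eq = odd≢double x (2 ^ m) (trans eq (2^-suc m))

half-2^suc : ∀ m x → x + x ≡ 2 ^ suc m → x ≡ 2 ^ m
half-2^suc m x eq = double-injective x (2 ^ m) (trans eq (2^-suc m))

halve-< : ∀ x y → x + x < y + y → x < y
halve-< x y lt with x <? y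
... | yes x<y = x<y
... | no  x≮y = contradiction lt (≤⇒≯ (+-mono-≤ (≮⇒≥ x≮y) (≮⇒≥ x≮y)))

*+≡*+⇒+≤ : ∀ m {a b u v} → a < b → m * a + u ≡ m * b + v → m + v ≤ u
*+≡*+⇒+≤ m {a} {b} {u} {v} a<b eq = +-cancelˡ-≤ (m * a) (m + v) u (begin
  m * a + (m + v)   ≡⟨ regroup m a v ⟩
  m * suc a + v     ≤⟨ +-monoˡ-≤ v (*-monoʳ-≤ m a<b) ⟩
  m * b + v         ≡⟨ eq ⟨
  m * a + u         ∎)
  where
  open ≤-Reasoning
  regroup : ∀ m a v → m * a + (m + v) ≡ m * suc a + v
  regroup = solve-∀

-- Binary expansions

-- Binary digits, least significant first.
inc : List Bool → List Bool
inc []           = true ∷ []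
inc (false ∷ bs) = true ∷ bs
inc (true ∷ bs)  = false ∷ inc bs

toBits : ℕ → List Bool
toBits zero    = []
toBits (suc n) = inc (toBits n)

ones : List Bool → ℕ
ones []           = 0
ones (true ∷ bs)  = suc (ones bs)
ones (false ∷ bs) = ones bs

lowZeros : List Bool → ℕ
lowZeros []           = 0
lowZeros (true ∷ _)   = 0
lowZeros (false ∷ bs) = suc (lowZeros bs)

popcount : ℕ → ℕ
popcount n = ones (toBits n)

-- The 2-adic valuation, with junk value ν₂ 0 = 0.
ν₂ : ℕ → ℕ
ν₂ n = lowZeros (toBits n)

doubleBits : List Bool → List Bool
doubleBits []       = []
doubleBits (b ∷ bs) = false ∷ b ∷ bs

toBits-double : ∀ q → toBits (q + q) ≡ doubleBits (toBits q)
toBits-double zero = refl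
toBits-double (suc q) rewrite +-suc q q | toBits-double q = inc-inc-double (toBits q)
  where
  inc-inc-double : ∀ bs → inc (inc (doubleBits bs)) ≡ doubleBits (inc bs)
  inc-inc-double []           = refl
  inc-inc-double (false ∷ bs) = refl
  inc-inc-double (true ∷ bs)  = refl

toBits-odd : ∀ q → toBits (suc (q + q)) ≡ true ∷ toBits q
toBits-odd q rewrite toBits-double q = inc-double (toBits q)
  where
  inc-double : ∀ bs → inc (doubleBits bs) ≡ true ∷ bs
  inc-double []      = refl
  inc-double (_ ∷ _) = refl

toBits-even : ∀ q → toBits (suc q + suc q) ≡ false ∷ toBits (suc q)
toBits-even q rewrite toBits-double (suc q) = double-inc (toBits q)
  where
  double-inc : ∀ bs → doubleBits (inc bs) ≡ false ∷ inc bs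
  double-inc []           = refl
  double-inc (false ∷ bs) = refl
  double-inc (true ∷ bs)  = refl

popcount-odd : ∀ q → popcount (suc (q + q)) ≡ suc (popcount q)
popcount-odd q rewrite toBits-odd q = refl

popcount-double : ∀ q → popcount (q + q) ≡ popcount q
popcount-double zero    = refl
popcount-double (suc q) rewrite toBits-even q = refl

ν₂-odd : ∀ q → ν₂ (suc (q + q)) ≡ 0
ν₂-odd q rewrite toBits-odd q = refl

ν₂-double : ∀ q → ν₂ (suc q + suc q) ≡ suc (ν₂ (suc q))
ν₂-double q rewrite toBits-even q = refl

-- Adding one clears the ν₂ (suc a) trailing ones of a and sets one bit.
popcount-carry : ∀ a → popcount a + 1 ≡ popcount (suc a) + ν₂ (suc a)
popcount-carry a = ones-inc (toBits a)
  where
  ones-inc : ∀ bs → ones bs + 1 ≡ ones (inc bs) + lowZeros (inc bs)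
  ones-inc []           = refl
  ones-inc (false ∷ bs) = trans (+-comm (ones bs) 1) (sym (+-identityʳ _))
  ones-inc (true ∷ bs)  = trans (cong suc (ones-inc bs)) (sym (+-suc _ _))

data EvenOdd : ℕ → Set where
  even : ∀ q → EvenOdd (q + q)
  odd  : ∀ q → EvenOdd (suc (q + q))

evenOdd : ∀ n → EvenOdd n
evenOdd zero = even 0
evenOdd (suc n) with evenOdd n
... | even q = odd q
... | odd q  = subst EvenOdd (cong suc (+-suc q q)) (even (suc q))

halves-rec : (P : ℕ → Set) → P 0 → (∀ q → P q → P (suc (q + q))) →
             (∀ q → P (suc q) → P (suc q + suc q)) → ∀ n → P n
halves-rec P p0 podd peven = <-rec P step
  where
  step : ∀ n → (∀ {m} → m < n → P m) → P n
  step n rec with evenOdd n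
  ... | even zero    = p0
  ... | even (suc q) = peven q (rec (s≤s (m≤n+m (suc q) q)))
  ... | odd q        = podd q (rec (s≤s (m≤m+n q q)))

popcount-suc-≤ : ∀ a → popcount (suc a) ≤ suc (popcount a)
popcount-suc-≤ a = begin
  popcount (suc a)                ≤⟨ m≤m+n _ _ ⟩
  popcount (suc a) + ν₂ (suc a)   ≡⟨ sym (popcount-carry a) ⟩
  popcount a + 1                  ≡⟨ +-comm (popcount a) 1 ⟩
  suc (popcount a)                ∎
  where open ≤-Reasoning

popcount-2^+-≤ : ∀ e a → popcount (2 ^ e + a) ≤ suc (popcount a)
popcount-2^+-≤ zero    a = popcount-suc-≤ a
popcount-2^+-≤ (suc e) a = by-evenOdd (evenOdd a)
  where
  open ≤-Reasoning
  double-case : ∀ q → popcount (2 ^ suc e + (q + q)) ≤ suc (popcount (q + q))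
  double-case q = begin
    popcount (2 ^ suc e + (q + q))              ≡⟨ cong popcount (2^suc+double e q) ⟩
    popcount ((2 ^ e + q) + (2 ^ e + q))        ≡⟨ popcount-double (2 ^ e + q) ⟩
    popcount (2 ^ e + q)                        ≤⟨ popcount-2^+-≤ e q ⟩
    suc (popcount q)                            ≡⟨ cong suc (sym (popcount-double q)) ⟩
    suc (popcount (q + q))                      ∎
  by-evenOdd : ∀ {a} → EvenOdd a → popcount (2 ^ suc e + a) ≤ suc (popcount a)
  by-evenOdd (even q) = double-case q
  by-evenOdd (odd q)  = begin
    popcount (2 ^ suc e + suc (q + q))          ≡⟨ cong popcount (2^suc+odd e q) ⟩
    popcount (suc ((2 ^ e + q) + (2 ^ e + q)))  ≡⟨ popcount-odd (2 ^ e + q) ⟩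
    suc (popcount (2 ^ e + q))                  ≤⟨ s≤s (popcount-2^+-≤ e q) ⟩
    suc (suc (popcount q))                      ≡⟨ cong suc (sym (popcount-odd q)) ⟩
    suc (popcount (suc (q + q)))                ∎

popcount-≤ : ∀ a → popcount a ≤ a
popcount-≤ = halves-rec (λ a → popcount a ≤ a) z≤n
  (λ q ih → subst (_≤ suc (q + q)) (sym (popcount-odd q)) (s≤s (≤-trans ih (m≤m+n q q))))
  (λ q ih → subst (_≤ suc q + suc q) (sym (popcount-double (suc q))) (≤-trans ih (m≤m+n (suc q) (suc q))))

2^popcount≤ : ∀ a → 2 ^ popcount a ≤ suc a
2^popcount≤ = halves-rec (λ a → 2 ^ popcount a ≤ suc a) ≤-refl
  (λ q ih → subst (λ k → 2 ^ k ≤ suc (suc (q + q))) (sym (popcount-odd q))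
              (subst (2 * 2 ^ popcount q ≤_) (2*suc q) (*-monoʳ-≤ 2 ih)))
  (λ q ih → subst (λ k → 2 ^ k ≤ suc (suc q + suc q)) (sym (popcount-double (suc q)))
              (≤-trans ih (s≤s (m≤m+n (suc q) (suc q)))))
  where
  2*suc : ∀ q → 2 * suc q ≡ suc (suc (q + q))
  2*suc = solve-∀

popcount-<2^ : ∀ {a} m → a < 2 ^ m → popcount a ≤ m
popcount-<2^ {a} m a<2^m = 2^-cancel-≤ (≤-trans (2^popcount≤ a) a<2^m)

2^popcount+ν₂≤ : ∀ a → 1 ≤ a → 2 ^ (popcount a + ν₂ a) ≤ 2 * a
2^popcount+ν₂≤ = halves-rec (λ a → 1 ≤ a → 2 ^ (popcount a + ν₂ a) ≤ 2 * a) (λ ())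
  (λ q _ _ → subst (λ k → 2 ^ k ≤ 2 * suc (q + q))
               (sym (trans (cong₂ _+_ (popcount-odd q) (ν₂-odd q)) (+-identityʳ _)))
               (*-monoʳ-≤ 2 (≤-trans (2^popcount≤ q) (s≤s (m≤m+n q q)))))
  (λ q ih _ → subst (λ k → 2 ^ k ≤ 2 * (suc q + suc q))
               (sym (trans (cong₂ _+_ (popcount-double (suc q)) (ν₂-double q)) (+-suc _ _)))
               (*-monoʳ-≤ 2 (subst (2 ^ (popcount (suc q) + ν₂ (suc q)) ≤_)
                                   (cong (suc q +_) (+-identityʳ (suc q))) (ih (s≤s z≤n)))))

popcount+ν₂≤ : ∀ a → 1 ≤ a → popcount a + ν₂ a ≤ a
popcount+ν₂≤ = halves-rec (λ a → 1 ≤ a → popcount a + ν₂ a ≤ a) (λ ())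
  (λ q _ _ → subst (_≤ suc (q + q)) (sym (trans (cong₂ _+_ (popcount-odd q) (ν₂-odd q)) (+-identityʳ _)))
               (s≤s (≤-trans (popcount-≤ q) (m≤m+n q q))))
  (λ q ih _ → subst (_≤ suc q + suc q) (sym (trans (cong₂ _+_ (popcount-double (suc q)) (ν₂-double q)) (+-suc _ _)))
               (≤-trans (s≤s (ih (s≤s z≤n))) (s≤s (m≤n+m (suc q) q))))

popcount-2^+ : ∀ m {c} → c < 2 ^ m → popcount (2 ^ m + c) ≡ suc (popcount c)
popcount-2^+ zero    (s≤s z≤n) = refl
popcount-2^+ (suc m) c<2^m+1   = by-evenOdd (evenOdd _) c<2^m+1
  where
  double-case : ∀ q → q + q < 2 ^ suc m → popcount (2 ^ suc m + (q + q)) ≡ suc (popcount (q + q))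
  double-case q lt = begin
    popcount (2 ^ suc m + (q + q))          ≡⟨ cong popcount (2^suc+double m q) ⟩
    popcount ((2 ^ m + q) + (2 ^ m + q))    ≡⟨ popcount-double (2 ^ m + q) ⟩
    popcount (2 ^ m + q)                    ≡⟨ popcount-2^+ m (halve-< q (2 ^ m) (subst (q + q <_) (2^-suc m) lt)) ⟩
    suc (popcount q)                        ≡⟨ cong suc (popcount-double q) ⟨
    suc (popcount (q + q))                  ∎
    where open ≡-Reasoning
  by-evenOdd : ∀ {c} → EvenOdd c → c < 2 ^ suc m → popcount (2 ^ suc m + c) ≡ suc (popcount c)
  by-evenOdd (even q)   = double-case q
  by-evenOdd (odd q) lt = begin
    popcount (2 ^ suc m + suc (q + q))          ≡⟨ cong popcount (2^suc+odd m q) ⟩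
    popcount (suc ((2 ^ m + q) + (2 ^ m + q)))  ≡⟨ popcount-odd (2 ^ m + q) ⟩
    suc (popcount (2 ^ m + q))                  ≡⟨ cong suc (popcount-2^+ m q<2^m) ⟩
    suc (suc (popcount q))                      ≡⟨ cong suc (popcount-odd q) ⟨
    suc (popcount (suc (q + q)))                ∎
    where
    open ≡-Reasoning
    q<2^m : q < 2 ^ m
    q<2^m = halve-< q (2 ^ m) (subst (q + q <_) (2^-suc m) (<⇒≤ lt))

ν₂-2^+ : ∀ m {c} → 1 ≤ c → c < 2 ^ m → ν₂ (2 ^ m + c) ≡ ν₂ c
ν₂-2^+ zero    (s≤s _) (s≤s ())
ν₂-2^+ (suc m) 1≤c c<2^m+1 = by-evenOdd (evenOdd _) 1≤c c<2^m+1
  where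
  by-evenOdd : ∀ {c} → EvenOdd c → 1 ≤ c → c < 2 ^ suc m → ν₂ (2 ^ suc m + c) ≡ ν₂ c
  by-evenOdd (odd q) _ _ = begin
    ν₂ (2 ^ suc m + suc (q + q))          ≡⟨ cong ν₂ (2^suc+odd m q) ⟩
    ν₂ (suc ((2 ^ m + q) + (2 ^ m + q)))  ≡⟨ ν₂-odd (2 ^ m + q) ⟩
    0                                     ≡⟨ ν₂-odd q ⟨
    ν₂ (suc (q + q))                      ∎
    where open ≡-Reasoning
  by-evenOdd (even (suc q)) _ lt = begin
    ν₂ (2 ^ suc m + (suc q + suc q))              ≡⟨ cong ν₂ (2^suc+double m (suc q)) ⟩
    ν₂ ((2 ^ m + suc q) + (2 ^ m + suc q))        ≡⟨ cong (λ k → ν₂ (k + k)) (+-suc (2 ^ m) q) ⟩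
    ν₂ (suc (2 ^ m + q) + suc (2 ^ m + q))        ≡⟨ ν₂-double (2 ^ m + q) ⟩
    suc (ν₂ (suc (2 ^ m + q)))                    ≡⟨ cong (λ k → suc (ν₂ k)) (+-suc (2 ^ m) q) ⟨
    suc (ν₂ (2 ^ m + suc q))                      ≡⟨ cong suc (ν₂-2^+ m (s≤s z≤n) q<2^m) ⟩
    suc (ν₂ (suc q))                              ≡⟨ ν₂-double q ⟨
    ν₂ (suc q + suc q)                            ∎
    where
    open ≡-Reasoning
    q<2^m : suc q < 2 ^ m
    q<2^m = halve-< (suc q) (2 ^ m) (subst (suc q + suc q <_) (2^-suc m) lt)

popcount-2^ : ∀ m → popcount (2 ^ m) ≡ 1
popcount-2^ m = trans (cong popcount (sym (+-identityʳ (2 ^ m)))) (popcount-2^+ m (1≤2^ m))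

popcount-pred-2^ : ∀ m {a} → suc a ≡ 2 ^ m → popcount a ≡ m
popcount-pred-2^ zero    refl = refl
popcount-pred-2^ (suc m) {a} eq with m≤n⇒∃[o]m+o≡n (1≤2^ m)
... | b , suc-b≡2^m = begin
  popcount a                ≡⟨ cong popcount a≡ ⟩
  popcount (suc (b + b))    ≡⟨ popcount-odd b ⟩
  suc (popcount b)          ≡⟨ cong suc (popcount-pred-2^ m suc-b≡2^m) ⟩
  suc m                     ∎
  where
  open ≡-Reasoning
  a≡ : a ≡ suc (b + b)
  a≡ = suc-injective (begin
    suc a               ≡⟨ eq ⟩
    2 ^ suc m           ≡⟨ 2^-suc m ⟩
    2 ^ m + 2 ^ m       ≡⟨ cong₂ _+_ suc-b≡2^m suc-b≡2^m ⟨
    suc b + suc b       ≡⟨ cong suc (+-suc b b) ⟩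
    suc (suc (b + b))   ∎)

-- If a + d = 2^m then the binary digits of a - 1 and d are complementary below position m.
popcount-complement : ∀ m {a d} → 1 ≤ a → a + d ≡ 2 ^ m → popcount a + popcount d + ν₂ a ≡ suc m
popcount-complement zero {suc zero}    {zero}  _ _  = refl
popcount-complement zero {suc zero}    {suc d} _ ()
popcount-complement zero {suc (suc a)}         _ ()
popcount-complement (suc m) 1≤a eq = by-evenOdd (evenOdd _) (evenOdd _) 1≤a eq
  where
  open ≡-Reasoning
  by-evenOdd : ∀ {a d} → EvenOdd a → EvenOdd d → 1 ≤ a → a + d ≡ 2 ^ suc m →
               popcount a + popcount d + ν₂ a ≡ suc (suc m)
  by-evenOdd (even zero)    _        () _
  by-evenOdd (even (suc p)) (even q) _  eq = begin
    popcount (suc p + suc p) + popcount (q + q) + ν₂ (suc p + suc p)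
      ≡⟨ cong₂ _+_ (cong₂ _+_ (popcount-double (suc p)) (popcount-double q)) (ν₂-double p) ⟩
    popcount (suc p) + popcount q + suc (ν₂ (suc p))
      ≡⟨ +-suc _ _ ⟩
    suc (popcount (suc p) + popcount q + ν₂ (suc p))
      ≡⟨ cong suc (popcount-complement m {suc p} {q} (s≤s z≤n)
                     (half-2^suc m (suc p + q) (trans (sym (double-+ (suc p) q)) eq))) ⟩
    suc (suc m) ∎
  by-evenOdd (odd p) (odd q) _ eq = begin
    popcount (suc (p + p)) + popcount (suc (q + q)) + ν₂ (suc (p + p))
      ≡⟨ cong₂ _+_ (cong₂ _+_ (popcount-odd p) (popcount-odd q)) (ν₂-odd p) ⟩
    suc (popcount p) + suc (popcount q) + 0
      ≡⟨ shuffle (popcount p) (popcount q) ⟩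
    suc ((popcount p + 1) + popcount q)
      ≡⟨ cong (λ k → suc (k + popcount q)) (popcount-carry p) ⟩
    suc ((popcount (suc p) + ν₂ (suc p)) + popcount q)
      ≡⟨ cong suc (exchange (popcount (suc p)) (ν₂ (suc p)) (popcount q)) ⟩
    suc (popcount (suc p) + popcount q + ν₂ (suc p))
      ≡⟨ cong suc (popcount-complement m {suc p} {q} (s≤s z≤n)
                     (half-2^suc m (suc p + q) (trans (sym (odd-+-odd p q)) eq))) ⟩
    suc (suc m) ∎
    where
    shuffle : ∀ x y → suc x + suc y + 0 ≡ suc ((x + 1) + y)
    shuffle = solve-∀
    exchange : ∀ x y z → (x + y) + z ≡ x + z + y
    exchange = solve-∀
  by-evenOdd (even p) (odd q)  _ eq = ⊥-elim (odd≢2^suc m (p + q) (trans (sym (double-+-odd p q)) eq))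
  by-evenOdd (odd p)  (even q) _ eq = ⊥-elim (odd≢2^suc m (p + q) (trans (sym (odd-+-double p q)) eq))

ν₂-complement : ∀ m {a d} → 1 ≤ a → 1 ≤ d → a + d ≡ 2 ^ m → ν₂ a ≡ ν₂ d
ν₂-complement zero {suc zero}    {suc d} _ _ ()
ν₂-complement zero {suc (suc a)}         _ _ ()
ν₂-complement (suc m) 1≤a 1≤d eq = by-evenOdd (evenOdd _) (evenOdd _) 1≤a 1≤d eq
  where
  by-evenOdd : ∀ {a d} → EvenOdd a → EvenOdd d → 1 ≤ a → 1 ≤ d → a + d ≡ 2 ^ suc m → ν₂ a ≡ ν₂ d
  by-evenOdd (even zero)    _              () _  _
  by-evenOdd _              (even zero)    _  () _
  by-evenOdd (even (suc p)) (even (suc q)) _  _  eq = begin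
    ν₂ (suc p + suc p)    ≡⟨ ν₂-double p ⟩
    suc (ν₂ (suc p))      ≡⟨ cong suc (ν₂-complement m {suc p} {suc q} (s≤s z≤n) (s≤s z≤n)
                                 (half-2^suc m (suc p + suc q) (trans (sym (double-+ (suc p) (suc q))) eq))) ⟩
    suc (ν₂ (suc q))      ≡⟨ ν₂-double q ⟨
    ν₂ (suc q + suc q)    ∎
    where open ≡-Reasoning
  by-evenOdd (odd p)  (odd q)  _ _ _  = trans (ν₂-odd p) (sym (ν₂-odd q))
  by-evenOdd (even p) (odd q)  _ _ eq = ⊥-elim (odd≢2^suc m (p + q) (trans (sym (double-+-odd p q)) eq))
  by-evenOdd (odd p)  (even q) _ _ eq = ⊥-elim (odd≢2^suc m (p + q) (trans (sym (odd-+-double p q)) eq))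

ν₂-2^ : ∀ m → ν₂ (2 ^ m) ≡ m
ν₂-2^ m = suc-injective (begin
  suc (ν₂ (2 ^ m))                                ≡⟨ cong (λ p → p + popcount 0 + ν₂ (2 ^ m)) (popcount-2^ m) ⟨
  popcount (2 ^ m) + popcount 0 + ν₂ (2 ^ m)      ≡⟨ popcount-complement m (1≤2^ m) (+-identityʳ (2 ^ m)) ⟩
  suc m                                           ∎)
  where open ≡-Reasoning

≤1+popcount+ν₂⇒≤4 : ∀ {δ} → 1 ≤ δ → δ ≤ suc (popcount δ + ν₂ δ) → δ ≤ 4
≤1+popcount+ν₂⇒≤4 {δ} 1≤δ δ≤ =
  ≤-trans δ≤ (s≤s (2^≤2*suc⇒≤3 _ (≤-trans (2^popcount+ν₂≤ δ 1≤δ) (*-monoʳ-≤ 2 δ≤))))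

-- Sums of powers of two

data PowSum : ℕ → ℕ → Set where
  none : PowSum 0 0
  add  : ∀ e {a t} → PowSum a t → PowSum (2 ^ e + a) (suc t)

PowSum⇒popcount≤ : ∀ {a t} → PowSum a t → popcount a ≤ t
PowSum⇒popcount≤ none            = z≤n
PowSum⇒popcount≤ (add e {a} sum) = ≤-trans (popcount-2^+-≤ e a) (s≤s (PowSum⇒popcount≤ sum))

PowSum⇒≤ : ∀ {a t} → PowSum a t → t ≤ a
PowSum⇒≤ none        = z≤n
PowSum⇒≤ (add e sum) = +-mono-≤ (1≤2^ e) (PowSum⇒≤ sum)

PowSum-double : ∀ {a t} → PowSum a t → PowSum (a + a) t
PowSum-double none                = none
PowSum-double (add e {a} {t} sum) =
  subst (λ x → PowSum x (suc t)) (2^suc+double e a) (add (suc e) (PowSum-double sum))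

PowSum-binary : ∀ a → PowSum a (popcount a)
PowSum-binary = halves-rec (λ a → PowSum a (popcount a)) none
  (λ q sum → subst (PowSum (suc (q + q))) (sym (popcount-odd q)) (add 0 (PowSum-double sum)))
  (λ q sum → subst (PowSum (suc q + suc q)) (sym (popcount-double (suc q))) (PowSum-double sum))

-- A summand 2^(e+1) splits into 2^e + 2^e; only when every summand is 1 is t = a.
PowSum-split : ∀ {a t} → PowSum a t → t < a → PowSum a (suc t)
PowSum-split (add zero sum)          (s≤s t<a) = add zero (PowSum-split sum t<a)
PowSum-split (add (suc e) {a} {t} sum) _       =
  subst (λ x → PowSum x (suc (suc t))) 2^e+[2^e+a]≡ (add e (add e sum))
  where
  2^e+[2^e+a]≡ : 2 ^ e + (2 ^ e + a) ≡ 2 ^ suc e + a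
  2^e+[2^e+a]≡ = trans (sym (+-assoc (2 ^ e) (2 ^ e) a)) (cong (_+ a) (sym (2^-suc e)))

popcount≤⇒PowSum : ∀ {a t} → popcount a ≤ t → t ≤ a → PowSum a t
popcount≤⇒PowSum {a} popcount≤t t≤a with m≤n⇒∃[o]m+o≡n popcount≤t
... | k , refl = extra k t≤a
  where
  extra : ∀ k → popcount a + k ≤ a → PowSum a (popcount a + k)
  extra zero    _ = subst (PowSum a) (sym (+-identityʳ _)) (PowSum-binary a)
  extra (suc k) le = subst (PowSum a) (sym (+-suc _ k))
    (PowSum-split (extra k (≤-trans (n≤1+n _) (subst (_≤ a) (+-suc _ k) le))) (subst (_≤ a) (+-suc _ k) le))

-- The bounds on t put c = k + m - t between popcount d and d.
complement-PowSum : ∀ m k {a d t} → 1 ≤ a → 1 ≤ d → a + d ≡ 2 ^ m →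
                    k + popcount a ≤ t → t < k + popcount a + ν₂ a →
                    Σ ℕ λ c → t + c ≡ k + m × PowSum d c
complement-PowSum m k {a} {d} {t} 1≤a 1≤d a+d≡2^m k+P≤t t<k+P+v =
  c , t+c≡k+m , popcount≤⇒PowSum D≤c c≤d
  where
  P = popcount a
  D = popcount d
  v = ν₂ a
  key : P + D + v ≡ suc m
  key = popcount-complement m 1≤a a+d≡2^m
  t+D≤k+m : t + D ≤ k + m
  t+D≤k+m = ≤-pred (begin
    suc t + D         ≤⟨ +-monoˡ-≤ D t<k+P+v ⟩
    k + P + v + D     ≡⟨ regroup k P v D ⟩
    k + (P + D + v)   ≡⟨ cong (k +_) key ⟩
    k + suc m         ≡⟨ +-suc k m ⟩
    suc (k + m)       ∎)
    where
    open ≤-Reasoning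
    regroup : ∀ k P v D → k + P + v + D ≡ k + (P + D + v)
    regroup = solve-∀
  c = k + m ∸ t
  t+c≡k+m : t + c ≡ k + m
  t+c≡k+m = m+[n∸m]≡n (≤-trans (m≤m+n t D) t+D≤k+m)
  D≤c : popcount d ≤ c
  D≤c = +-cancelˡ-≤ t (popcount d) c (≤-trans t+D≤k+m (≤-reflexive (sym t+c≡k+m)))
  c≤d : c ≤ d
  c≤d = +-cancelˡ-≤ t c d (begin
    t + c                                   ≡⟨ t+c≡k+m ⟩
    k + m                                   ≤⟨ +-monoʳ-≤ k (n≤1+n m) ⟩
    k + suc m                               ≡⟨ cong (k +_) key ⟨
    k + (P + D + v)                         ≡⟨ regroup k P D v ⟩
    (k + P) + (D + v)                       ≡⟨ cong (λ w → (k + P) + (D + w)) (ν₂-complement m 1≤a 1≤d a+d≡2^m) ⟩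
    (k + P) + (popcount d + ν₂ d)           ≤⟨ +-monoˡ-≤ (popcount d + ν₂ d) k+P≤t ⟩
    t + (popcount d + ν₂ d)                 ≤⟨ +-monoʳ-≤ t (popcount+ν₂≤ d 1≤d) ⟩
    t + d                                   ∎)
    where
    open ≤-Reasoning
    regroup : ∀ k P D v → k + (P + D + v) ≡ (k + P) + (D + v)
    regroup = solve-∀

-- The semigroup in the coordinates M * a + t

InP-+ : ∀ {n r a b} → InP n r a → InP n r b → InP n r (a + b)
InP-+ P-zero b∈ = b∈
InP-+ {n} {r} {b = b} (P-add i {a} a∈) b∈ =
  subst (InP n r) (sym (+-assoc (gen n r i) a b)) (P-add i (InP-+ a∈ b∈))

module Semigroup (n r : ℕ) where

  N : ℕ
  N = n + r

  M : ℕ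
  M = (2 ^ r + 1) * 2 ^ n

  s : ℕ → ℕ
  s = gen n r

  M≡ : M ≡ 2 ^ N + 2 ^ n
  M≡ = begin
    (2 ^ r + 1) * 2 ^ n         ≡⟨ *-distribʳ-+ (2 ^ n) (2 ^ r) 1 ⟩
    2 ^ r * 2 ^ n + 1 * 2 ^ n   ≡⟨ cong₂ _+_ (*-comm (2 ^ r) (2 ^ n)) (*-identityˡ (2 ^ n)) ⟩
    2 ^ n * 2 ^ r + 2 ^ n       ≡⟨ cong (_+ 2 ^ n) (^-distribˡ-+-* 2 n r) ⟨
    2 ^ N + 2 ^ n               ∎
    where open ≡-Reasoning

  s≡ : ∀ e → s e ≡ M * 2 ^ e + 1
  s≡ e = cong (_+ 1) (begin
    (2 ^ r + 1) * 2 ^ (n + e)       ≡⟨ cong ((2 ^ r + 1) *_) (^-distribˡ-+-* 2 n e) ⟩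
    (2 ^ r + 1) * (2 ^ n * 2 ^ e)   ≡⟨ *-assoc (2 ^ r + 1) (2 ^ n) (2 ^ e) ⟨
    M * 2 ^ e                       ∎)
    where open ≡-Reasoning

  s₀≡ : s 0 ≡ M + 1
  s₀≡ = trans (s≡ 0) (cong (_+ 1) (*-identityʳ M))

  s+M*+≡ : ∀ e a t → s e + (M * a + t) ≡ M * (2 ^ e + a) + suc t
  s+M*+≡ e a t = trans (cong (_+ (M * a + t)) (s≡ e)) (distribute M (2 ^ e) a t)
    where
    distribute : ∀ m p a t → (m * p + 1) + (m * a + t) ≡ m * (p + a) + suc t
    distribute = solve-∀

  s∈ : ∀ e → InP n r (s e)
  s∈ e = subst (InP n r) (+-identityʳ (s e)) (P-add e P-zero)

  M*0+0≡0 : M * 0 + 0 ≡ 0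
  M*0+0≡0 = cong (_+ 0) (*-zeroʳ M)

  PowSum⇒InP : ∀ {a t} → PowSum a t → InP n r (M * a + t)
  PowSum⇒InP none                = subst (InP n r) (sym M*0+0≡0) P-zero
  PowSum⇒InP (add e {a} {t} sum) = subst (InP n r) (s+M*+≡ e a t) (P-add e (PowSum⇒InP sum))

  InP⇒PowSum : ∀ {x} → InP n r x → Σ ℕ λ a → Σ ℕ λ t → x ≡ M * a + t × PowSum a t
  InP⇒PowSum P-zero = 0 , 0 , sym M*0+0≡0 , none
  InP⇒PowSum (P-add e x∈) with InP⇒PowSum x∈
  ... | a , t , refl , sum = 2 ^ e + a , suc t , s+M*+≡ e a t , add e sum

  -- x ∉ Ap(S, s 0) for x ∈ S means exactly Reducible x.
  Reducible : ℕ → Set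
  Reducible x = Σ ℕ λ y → InP n r y × y + s 0 ≡ x

  reducible-+ˡ : ∀ {x z} → InP n r z → Reducible x → Reducible (z + x)
  reducible-+ˡ {z = z} z∈ (y , y∈ , refl) = z + y , InP-+ z∈ y∈ , +-assoc z y (s 0)

  reducible-+ʳ : ∀ {x z} → Reducible x → InP n r z → Reducible (x + z)
  reducible-+ʳ {x} {z} x-red z∈ = subst Reducible (+-comm z x) (reducible-+ˡ z∈ x-red)

  M*+t+s₀≡ : ∀ a t → M * a + t + s 0 ≡ M * suc a + suc t
  M*+t+s₀≡ a t = begin
    M * a + t + s 0        ≡⟨ cong (M * a + t +_) s₀≡ ⟩
    M * a + t + (M + 1)    ≡⟨ regroup M a t ⟩
    M * suc a + suc t      ∎
    where
    open ≡-Reasoning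
    regroup : ∀ M a t → M * a + t + (M + 1) ≡ M * suc a + suc t
    regroup = solve-∀

  reducible-M*suc : ∀ {a t} → PowSum a t → Reducible (M * suc a + suc t)
  reducible-M*suc {a} {t} sum = M * a + t , PowSum⇒InP sum , M*+t+s₀≡ a t

  Reducible⇒M*suc : ∀ {x} → Reducible x → Σ ℕ λ b → Σ ℕ λ u → PowSum b u × M * suc b + suc u ≡ x
  Reducible⇒M*suc (y , y∈ , refl) with InP⇒PowSum y∈
  ... | b , u , refl , sum = b , u , sum , sym (M*+t+s₀≡ b u)

  -- One of the two copies of M beyond s 0 is absorbed into the t-coordinate.
  reducible-M*2+ : ∀ {a t} → PowSum a (t + M) → Reducible (M * (2 + a) + suc t)
  reducible-M*2+ {a} {t} sum = M * a + (t + M) , PowSum⇒InP sum , (begin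
    M * a + (t + M) + s 0        ≡⟨ cong (M * a + (t + M) +_) s₀≡ ⟩
    M * a + (t + M) + (M + 1)    ≡⟨ regroup M a t ⟩
    M * (2 + a) + suc t          ∎)
    where
    open ≡-Reasoning
    regroup : ∀ M a t → M * a + (t + M) + (M + 1) ≡ M * (2 + a) + suc t
    regroup = solve-∀

  reducible-s+-suc : ∀ i {A a t} → 2 ^ i + A ≡ suc a → popcount a ≤ t → t ≤ a → Reducible (s i + (M * A + t))
  reducible-s+-suc i {A} {a} {t} 2^i+A≡ p≤t t≤a =
    subst Reducible (sym (trans (s+M*+≡ i A t) (cong (λ z → M * z + suc t) 2^i+A≡)))
          (reducible-M*suc (popcount≤⇒PowSum p≤t t≤a))

  maximal-criterion : ∀ {x} → InP n r x → ¬ Reducible x → (∀ i → Reducible (s i + x)) → MaxAp n r (s 0) x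
  maximal-criterion {x} x∈ x-irr s+x-red = (x∈ , x-irr) , above
    where
    above : ∀ y → InAp n r (s 0) y → x ≤[ n , r ] y → y ≡ x
    above y _ (_ , P-zero , x+0≡y) = trans (sym x+0≡y) (+-identityʳ x)
    above y (_ , y-irr) (_ , P-add i {c} c∈ , x+[s+c]≡y) =
      ⊥-elim (y-irr (subst Reducible (trans (exchange (s i) x c) x+[s+c]≡y) (reducible-+ʳ (s+x-red i) c∈)))
      where
      exchange : ∀ u x c → u + x + c ≡ x + (u + c)
      exchange = solve-∀

  irreducible-criterion : ∀ {a A t} → suc a ≡ A → t ≤ popcount a → t ≤ M → A ≤ M + t → ¬ Reducible (M * A + t)
  irreducible-criterion {a} {_} {t} refl t≤popcount t≤M suc-a≤M+t x-red with Reducible⇒M*suc x-red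
  ... | b , u , sum , same with <-cmp b a
  ... | tri< b<a _ _ = <-irrefl refl (begin-strict
    M + t       ≤⟨ *+≡*+⇒+≤ M (s≤s b<a) same ⟩
    suc u       ≤⟨ s≤s (PowSum⇒≤ sum) ⟩
    suc b       <⟨ s≤s b<a ⟩
    suc a       ≤⟨ suc-a≤M+t ⟩
    M + t       ∎)
    where open ≤-Reasoning
  ... | tri≈ _ refl _ = <-irrefl refl (begin-strict
    t           ≤⟨ t≤popcount ⟩
    popcount a  ≤⟨ PowSum⇒popcount≤ sum ⟩
    u           <⟨ n<1+n u ⟩
    suc u       ≡⟨ +-cancelˡ-≡ (M * suc a) _ _ same ⟩
    t           ∎)
    where open ≤-Reasoning
  ... | tri> _ _ a<b = <-irrefl refl (begin-strict
    M           <⟨ m<m+n M (s≤s z≤n) ⟩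
    M + suc u   ≤⟨ *+≡*+⇒+≤ M (s≤s a<b) (sym same) ⟩
    t           ≤⟨ t≤M ⟩
    M           ∎)
    where open ≤-Reasoning

  irreducible⇒<popcount+ν₂ : ∀ {a t} → PowSum a t → 1 ≤ a → ¬ Reducible (M * a + t) → t < popcount a + ν₂ a
  irreducible⇒<popcount+ν₂ {suc a} {zero}  ()  _ _
  irreducible⇒<popcount+ν₂ {suc a} {suc t} sum _ irr with popcount a ≤? t
  ... | yes p≤t = ⊥-elim (irr (reducible-M*suc (popcount≤⇒PowSum p≤t (≤-pred (PowSum⇒≤ sum)))))
  ... | no  p≰t = ≤-trans (s≤s (≰⇒> p≰t)) (≤-reflexive (trans (+-comm 1 (popcount a)) (popcount-carry a)))

  M*2^suc : ∀ e → M * 2 ^ suc e ≡ M * 2 ^ e + M * 2 ^ e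
  M*2^suc e = trans (cong (M *_) (2^-suc e)) (*-distribˡ-+ M (2 ^ e) (2 ^ e))

  -- Telescoping, since s e = M * 2^e + 1.
  sumGen+M*2^≡ : ∀ a len → sumGen n r a len + M * 2 ^ a ≡ M * 2 ^ (a + len) + len
  sumGen+M*2^≡ a zero    = trans (cong (λ e → M * 2 ^ e) (sym (+-identityʳ a))) (sym (+-identityʳ _))
  sumGen+M*2^≡ a (suc len) = begin
    s a + S + X                          ≡⟨ cong (λ y → y + S + X) (s≡ a) ⟩
    X + 1 + S + X                        ≡⟨ regroup X S ⟩
    suc (S + (X + X))                    ≡⟨ cong (λ y → suc (S + y)) (M*2^suc a) ⟨
    suc (S + M * 2 ^ suc a)              ≡⟨ cong suc (sumGen+M*2^≡ (suc a) len) ⟩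
    suc (M * 2 ^ (suc a + len) + len)    ≡⟨ +-suc _ len ⟨
    M * 2 ^ (suc a + len) + suc len      ≡⟨ cong (λ e → M * 2 ^ e + suc len) (+-suc a len) ⟨
    M * 2 ^ (a + suc len) + suc len      ∎
    where
    open ≡-Reasoning
    S = sumGen n r (suc a) len
    X = M * 2 ^ a
    regroup : ∀ X S → X + 1 + S + X ≡ suc (S + (X + X))
    regroup = solve-∀

  2*s+sumGen≡ : ∀ i len → 2 * s i + sumGen n r (suc i) len ≡ M * 2 ^ (suc i + len) + (2 + len)
  2*s+sumGen≡ i len = begin
    2 * s i + S                          ≡⟨ cong (λ y → 2 * y + S) (s≡ i) ⟩
    2 * (X + 1) + S                      ≡⟨ regroup X S ⟩
    S + (X + X) + 2                      ≡⟨ cong (λ y → S + y + 2) (M*2^suc i) ⟨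
    S + M * 2 ^ suc i + 2                ≡⟨ cong (_+ 2) (sumGen+M*2^≡ (suc i) len) ⟩
    M * 2 ^ (suc i + len) + len + 2      ≡⟨ +-assoc _ len 2 ⟩
    M * 2 ^ (suc i + len) + (len + 2)    ≡⟨ cong (M * 2 ^ (suc i + len) +_) (+-comm len 2) ⟩
    M * 2 ^ (suc i + len) + (2 + len)    ∎
    where
    open ≡-Reasoning
    S = sumGen n r (suc i) len
    X = M * 2 ^ i
    regroup : ∀ X S → 2 * (X + 1) + S ≡ S + (X + X) + 2
    regroup = solve-∀

  -- The three families of the theorem, written as M * A + t: the first has t = N + 1 - i,
  -- the second t = n + 2 - j, and the third is 2 s 1 + s n + s N.
  data Target : ℕ → ℕ → Set where
    first  : ∀ {t} → suc n ≤ t → t ≤ N → Target (2 ^ N) t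
    second : ∀ {t} → 4 ≤ t → t ≤ suc n → Target (2 ^ N + 2 ^ n) t
    third  : Target (2 ^ N + 2 ^ n + 4) 4

  first-value : ∀ i L → suc i + L ≡ N → 2 * s i + sumGen n r (suc i) (N ∸ suc i) ≡ M * 2 ^ N + (2 + L)
  first-value i L eq = begin
    2 * s i + sumGen n r (suc i) (N ∸ suc i)    ≡⟨ cong (λ l → 2 * s i + sumGen n r (suc i) l) N∸≡L ⟩
    2 * s i + sumGen n r (suc i) L              ≡⟨ 2*s+sumGen≡ i L ⟩
    M * 2 ^ (suc i + L) + (2 + L)               ≡⟨ cong (λ e → M * 2 ^ e + (2 + L)) eq ⟩
    M * 2 ^ N + (2 + L)                         ∎
    where
    open ≡-Reasoning
    N∸≡L : N ∸ suc i ≡ L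
    N∸≡L = trans (cong (_∸ suc i) (sym eq)) (m+n∸m≡n (suc i) L)

  second-value : ∀ j L → suc j + L ≡ n →
                 2 * s j + sumGen n r (suc j) (n ∸ suc j) + s N ≡ M * (2 ^ N + 2 ^ n) + (3 + L)
  second-value j L eq = begin
    2 * s j + sumGen n r (suc j) (n ∸ suc j) + s N      ≡⟨ cong (λ l → 2 * s j + sumGen n r (suc j) l + s N) n∸≡L ⟩
    2 * s j + sumGen n r (suc j) L + s N                ≡⟨ cong₂ _+_ (2*s+sumGen≡ j L) (s≡ N) ⟩
    M * 2 ^ (suc j + L) + (2 + L) + (M * 2 ^ N + 1)     ≡⟨ cong (λ e → M * 2 ^ e + (2 + L) + (M * 2 ^ N + 1)) eq ⟩
    M * 2 ^ n + (2 + L) + (M * 2 ^ N + 1)               ≡⟨ regroup M (2 ^ n) (2 ^ N) L ⟩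
    M * (2 ^ N + 2 ^ n) + (3 + L)                       ∎
    where
    open ≡-Reasoning
    n∸≡L : n ∸ suc j ≡ L
    n∸≡L = trans (cong (_∸ suc j) (sym eq)) (m+n∸m≡n (suc j) L)
    regroup : ∀ M X Y L → M * X + (2 + L) + (M * Y + 1) ≡ M * (Y + X) + (3 + L)
    regroup = solve-∀

  third-value : 2 * s 1 + s n + s N ≡ M * (2 ^ N + 2 ^ n + 4) + 4
  third-value rewrite s≡ 1 | s≡ n | s≡ N = regroup M (2 ^ n) (2 ^ N)
    where
    regroup : ∀ M X Y → 2 * (M * 2 + 1) + (M * X + 1) + (M * Y + 1) ≡ M * (Y + X + 4) + 4
    regroup = solve-∀

  -- M * a + t ≤_S M * A + u for a target (A, u), the difference being M * b + c.
  record Dominated (a t : ℕ) : Set where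
    constructor dominated
    field
      {A u b c} : ℕ
      target    : Target A u
      gap       : PowSum b c
      a+b≡A     : a + b ≡ A
      t+c≡u     : t + c ≡ u

  module Bounded (2<n : 2 < n) (1≤r : 1 ≤ r) (2^r+1<2^n : 2 ^ r + 1 < 2 ^ n) where

    r<n : r < n
    r<n with r <? n
    ... | yes r<n = r<n
    ... | no  r≮n = contradiction 2^r+1<2^n (≤⇒≯ (≤-trans (^-monoʳ-≤ 2 (≮⇒≥ r≮n)) (m≤m+n (2 ^ r) 1)))

    n<N : n < N
    n<N = subst (_≤ N) (+-comm n 1) (+-monoʳ-≤ n 1≤r)

    N+2≤2^n : N + 2 ≤ 2 ^ n
    N+2≤2^n = ≤-trans (+-monoˡ-≤ 2 (+-monoʳ-≤ n (<⇒≤ r<n))) (m+m+2≤2^m n 2<n)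

    2^n+2^n≤2^N : 2 ^ n + 2 ^ n ≤ 2 ^ N
    2^n+2^n≤2^N = subst (_≤ 2 ^ N) (2^-suc n) (^-monoʳ-≤ 2 n<N)

    2^n<2^N : 2 ^ n < 2 ^ N
    2^n<2^N = ^-monoʳ-< 2 (s≤s (s≤s z≤n)) n<N

    2^n≤M : 2 ^ n ≤ M
    2^n≤M = subst (2 ^ n ≤_) (sym M≡) (m≤n+m (2 ^ n) (2 ^ N))

    2^N≤M : 2 ^ N ≤ M
    2^N≤M = subst (2 ^ N ≤_) (sym M≡) (m≤m+n (2 ^ N) (2 ^ n))

    N+2≤M : N + 2 ≤ M
    N+2≤M = ≤-trans N+2≤2^n 2^n≤M

    N<2^n : N < 2 ^ n
    N<2^n = ≤-trans (n≤1+n (suc N)) (subst (_≤ 2 ^ n) (+-comm N 2) N+2≤2^n)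

    8≤2^n : 8 ≤ 2 ^ n
    8≤2^n = ^-monoʳ-≤ 2 {3} 2<n

    4≤suc-n : 4 ≤ suc n
    4≤suc-n = s≤s 2<n

    Target⇒InTarget : ∀ {A t} → Target A t → InTarget n r (M * A + t)
    Target⇒InTarget (first {t} n<t t≤N)
      with m≤n⇒∃[o]m+o≡n (≤-trans (<⇒≤ 2<n) (<⇒≤ n<t)) | m≤n⇒∃[o]m+o≡n t≤N
    ... | L , refl | k , 2+L+k≡N = inj₁ (suc k , s≤s z≤n , suc-k≤r , sym (first-value (suc k) L length))
      where
      length : suc (suc k) + L ≡ N
      length = trans (regroup k L) 2+L+k≡N
        where
        regroup : ∀ k L → suc (suc k) + L ≡ 2 + L + k
        regroup = solve-∀
      suc-k≤r : suc k ≤ r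
      suc-k≤r = +-cancelˡ-≤ n (suc k) r (begin
        n + suc k     ≡⟨ +-suc n k ⟩
        suc n + k     ≤⟨ +-monoˡ-≤ k n<t ⟩
        2 + L + k     ≡⟨ 2+L+k≡N ⟩
        N             ∎)
        where open ≤-Reasoning
    Target⇒InTarget (second {t} 4≤t t≤suc-n) with m≤n⇒∃[o]m+o≡n 4≤t | m≤n⇒∃[o]m+o≡n t≤suc-n
    ... | L , refl | k , 4+L+k≡suc-n =
      inj₂ (inj₁ (suc k , s≤s z≤n , suc-k≤n∸2 , sym (second-value (suc k) (suc L) length)))
      where
      length : suc (suc k) + suc L ≡ n
      length = suc-injective (trans (regroup k L) 4+L+k≡suc-n)
        where
        regroup : ∀ k L → suc (suc (suc k) + suc L) ≡ 4 + L + k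
        regroup = solve-∀
      suc-k≤n∸2 : suc k ≤ n ∸ 2
      suc-k≤n∸2 = m+n≤o⇒m≤o∸n (suc k) (begin
        suc k + 2             ≤⟨ +-monoʳ-≤ (suc k) (s≤s (s≤s z≤n)) ⟩
        suc k + (2 + L)       ≡⟨ regroup k L ⟩
        suc (suc k) + suc L   ≡⟨ length ⟩
        n                     ∎)
        where
        open ≤-Reasoning
        regroup : ∀ k L → suc k + (2 + L) ≡ suc (suc k) + suc L
        regroup = solve-∀
    Target⇒InTarget third = inj₂ (inj₂ (sym third-value))

    InTarget⇒Target : ∀ {x} → InTarget n r x → Σ ℕ λ A → Σ ℕ λ t → Target A t × x ≡ M * A + t
    InTarget⇒Target (inj₁ (i , 1≤i , i≤r , x≡)) =
      2 ^ N , 2 + L , first suc-n≤2+L 2+L≤N , trans x≡ (first-value i L length)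
      where
      L = N ∸ suc i
      length : suc i + L ≡ N
      length = m+[n∸m]≡n (≤-trans (s≤s i≤r) (+-monoˡ-≤ r (≤-trans (s≤s z≤n) 2<n)))
      suc-n≤2+L : suc n ≤ 2 + L
      suc-n≤2+L = s≤s (+-cancelʳ-≤ r n (suc L) (begin
        n + r         ≡⟨ length ⟨
        suc i + L     ≤⟨ +-monoˡ-≤ L (s≤s i≤r) ⟩
        suc r + L     ≡⟨ +-comm (suc r) L ⟩
        L + suc r     ≡⟨ +-suc L r ⟩
        suc L + r     ∎))
        where open ≤-Reasoning
      2+L≤N : 2 + L ≤ N
      2+L≤N = ≤-trans (+-monoˡ-≤ L (s≤s 1≤i)) (≤-reflexive length)
    InTarget⇒Target (inj₂ (inj₁ (j , 1≤j , j≤n∸2 , x≡))) =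
      2 ^ N + 2 ^ n , 3 + L , second 4≤3+L 3+L≤suc-n , trans x≡ (second-value j L length)
      where
      L = n ∸ suc j
      j+2≤n : j + 2 ≤ n
      j+2≤n = subst (j + 2 ≤_) (m∸n+n≡m (≤-trans (n≤1+n 2) 2<n)) (+-monoˡ-≤ 2 j≤n∸2)
      length : suc j + L ≡ n
      length = m+[n∸m]≡n (≤-trans (subst (_≤ j + 2) (+-comm j 1) (+-monoʳ-≤ j (s≤s z≤n))) j+2≤n)
      4≤3+L : 4 ≤ 3 + L
      4≤3+L = +-monoʳ-≤ 3 (+-cancelˡ-≤ (suc j) 1 L (subst₂ _≤_ (+-suc j 1) (sym length) j+2≤n))
      3+L≤suc-n : 3 + L ≤ suc n
      3+L≤suc-n = s≤s (≤-trans (+-monoˡ-≤ L (s≤s 1≤j)) (≤-reflexive length))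
    InTarget⇒Target (inj₂ (inj₂ x≡)) = _ , _ , third , trans x≡ third-value

    -- Start from M * 2^(N+1) = M * (2^(N+1) - 1) + M, where 2^(N+1) - 2 is a sum of M powers
    -- of two, and double.
    M*2^-split : ∀ k → Σ ℕ λ a → Σ ℕ λ t → PowSum a t × 1 ≤ t × M * 2 ^ (suc N + k) ≡ M * suc a + t
    M*2^-split zero with m≤n⇒∃[o]m+o≡n (^-monoʳ-≤ 2 {1} {suc N} (s≤s z≤n))
    ... | a , 2+a≡2^N+1 = a , M , popcount≤⇒PowSum popcount-a≤M M≤a , ≤-trans (1≤2^ n) 2^n≤M , M*2^N+1≡
      where
      M*2^N+1≡ : M * 2 ^ (suc N + 0) ≡ M * suc a + M
      M*2^N+1≡ = begin
        M * 2 ^ (suc N + 0)     ≡⟨ cong (λ e → M * 2 ^ e) (+-identityʳ (suc N)) ⟩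
        M * 2 ^ suc N           ≡⟨ cong (M *_) 2+a≡2^N+1 ⟨
        M * (2 + a)             ≡⟨ regroup M a ⟩
        M * suc a + M           ∎
        where
        open ≡-Reasoning
        regroup : ∀ M a → M * (2 + a) ≡ M * suc a + M
        regroup = solve-∀
      popcount-a≤M : popcount a ≤ M
      popcount-a≤M = ≤-trans (popcount-<2^ (suc N) (subst (a <_) 2+a≡2^N+1 (n≤1+n (suc a))))
                             (≤-trans (n≤1+n (suc N)) (subst (_≤ M) (+-comm N 2) N+2≤M))
      M≤a : M ≤ a
      M≤a = +-cancelʳ-≤ 2 M a (begin
        M + 2                     ≡⟨ cong (_+ 2) M≡ ⟩
        2 ^ N + 2 ^ n + 2         ≡⟨ +-assoc (2 ^ N) (2 ^ n) 2 ⟩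
        2 ^ N + (2 ^ n + 2)       ≤⟨ +-monoʳ-≤ (2 ^ N) (+-monoʳ-≤ (2 ^ n) (≤-trans (m≤n+m 2 N) N+2≤2^n)) ⟩
        2 ^ N + (2 ^ n + 2 ^ n)   ≤⟨ +-monoʳ-≤ (2 ^ N) 2^n+2^n≤2^N ⟩
        2 ^ N + 2 ^ N             ≡⟨ 2^-suc N ⟨
        2 ^ suc N                 ≡⟨ 2+a≡2^N+1 ⟨
        2 + a                     ≡⟨ +-comm 2 a ⟩
        a + 2                     ∎)
        where open ≤-Reasoning
    M*2^-split (suc k) with M*2^-split k
    ... | a , t , sum , 1≤t , eq = suc (a + a) , t + t , sum′ , ≤-trans 1≤t (m≤m+n t t) , (begin
      M * 2 ^ (suc N + suc k)                     ≡⟨ cong (λ e → M * 2 ^ e) (+-suc (suc N) k) ⟩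
      M * 2 ^ suc (suc N + k)                     ≡⟨ M*2^suc (suc N + k) ⟩
      M * 2 ^ (suc N + k) + M * 2 ^ (suc N + k)   ≡⟨ cong₂ _+_ eq eq ⟩
      (M * suc a + t) + (M * suc a + t)           ≡⟨ regroup M a t ⟩
      M * suc (suc (a + a)) + (t + t)             ∎)
      where
      open ≡-Reasoning
      regroup : ∀ M a t → (M * suc a + t) + (M * suc a + t) ≡ M * suc (suc (a + a)) + (t + t)
      regroup = solve-∀
      sum′ : PowSum (suc (a + a)) (t + t)
      sum′ = popcount≤⇒PowSum (subst (_≤ t + t) (sym (popcount-odd a)) (+-mono-≤ 1≤t (PowSum⇒popcount≤ sum)))
                              (≤-trans (+-mono-≤ (PowSum⇒≤ sum) (PowSum⇒≤ sum)) (n≤1+n _))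

    reducible-s : ∀ e → N < e → Reducible (s e)
    reducible-s e N<e with m≤n⇒∃[o]m+o≡n N<e
    ... | k , refl with M*2^-split k
    ... | a , t , sum , _ , M*2^e≡ = subst Reducible (sym s-e≡) (reducible-M*suc sum)
      where
      s-e≡ : s (suc N + k) ≡ M * suc a + suc t
      s-e≡ = begin
        s (suc N + k)                 ≡⟨ s≡ (suc N + k) ⟩
        M * 2 ^ (suc N + k) + 1       ≡⟨ cong (_+ 1) M*2^e≡ ⟩
        M * suc a + t + 1             ≡⟨ +-assoc (M * suc a) t 1 ⟩
        M * suc a + (t + 1)           ≡⟨ cong (M * suc a +_) (+-comm t 1) ⟩
        M * suc a + suc t             ∎
        where open ≡-Reasoning

    reducible-s+-large : ∀ {x} i → N < i → InP n r x → Reducible (s i + x)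
    reducible-s+-large i N<i x∈ = reducible-+ʳ (reducible-s i N<i) x∈

    reducible-s+-2+ : ∀ {i A t} → i ≤ N → A ≤ 2 ^ N + 2 ^ N → t + M + 2 ≤ 2 ^ i + A → Reducible (s i + (M * A + t))
    reducible-s+-2+ {i} {A} {t} i≤N A≤ t+M+2≤ with m≤n⇒∃[o]m+o≡n (≤-trans (m≤n+m 2 (t + M)) t+M+2≤)
    ... | a , 2+a≡ = subst Reducible (sym (trans (s+M*+≡ i A t) (cong (λ z → M * z + suc t) (sym 2+a≡))))
                           (reducible-M*2+ (popcount≤⇒PowSum popcount≤ t+M≤a))
      where
      popcount≤ : popcount a ≤ t + M
      popcount≤ = ≤-trans (popcount-<2^ (2 + N) (begin-strict
        a                             <⟨ m<n+m a (s≤s z≤n) ⟩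
        2 + a                         ≡⟨ 2+a≡ ⟩
        2 ^ i + A                     ≤⟨ +-mono-≤ (^-monoʳ-≤ 2 i≤N) A≤ ⟩
        2 ^ N + (2 ^ N + 2 ^ N)           <⟨ +-monoˡ-< (2 ^ N + 2 ^ N) (m<m+n (2 ^ N) (1≤2^ N)) ⟩
        (2 ^ N + 2 ^ N) + (2 ^ N + 2 ^ N) ≡⟨ cong₂ _+_ (2^-suc N) (2^-suc N) ⟨
        2 ^ suc N + 2 ^ suc N             ≡⟨ 2^-suc (suc N) ⟨
        2 ^ (2 + N)                       ∎)) (≤-trans (subst (_≤ M) (+-comm N 2) N+2≤M) (m≤n+m M t))
        where open ≤-Reasoning
      t+M≤a : t + M ≤ a
      t+M≤a = +-cancelʳ-≤ 2 (t + M) a (subst (t + M + 2 ≤_) (trans (sym 2+a≡) (+-comm 2 a)) t+M+2≤)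

    popcount-2^N+2^n+ : ∀ {c} → c < 2 ^ n → popcount (2 ^ N + 2 ^ n + c) ≡ 2 + popcount c
    popcount-2^N+2^n+ {c} c<2^n = begin
      popcount (2 ^ N + 2 ^ n + c)      ≡⟨ cong popcount (+-assoc (2 ^ N) (2 ^ n) c) ⟩
      popcount (2 ^ N + (2 ^ n + c))    ≡⟨ popcount-2^+ N (<-≤-trans (+-monoʳ-< (2 ^ n) c<2^n) 2^n+2^n≤2^N) ⟩
      suc (popcount (2 ^ n + c))        ≡⟨ cong suc (popcount-2^+ n c<2^n) ⟩
      2 + popcount c                    ∎
      where open ≡-Reasoning

    first-maximal : ∀ {t} → suc n ≤ t → t ≤ N → MaxAp n r (s 0) (M * 2 ^ N + t)
    first-maximal {t} n<t t≤N = maximal-criterion (PowSum⇒InP sum) irreducible s+reducible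
      where
      sum : PowSum (2 ^ N) t
      sum = popcount≤⇒PowSum (subst (_≤ t) (sym (popcount-2^ N)) (≤-trans (s≤s z≤n) n<t))
                             (≤-trans t≤N (<⇒≤ (n<2^n N)))
      irreducible : ¬ Reducible (M * 2 ^ N + t)
      irreducible with m≤n⇒∃[o]m+o≡n (1≤2^ N)
      ... | b , suc-b≡2^N = irreducible-criterion suc-b≡2^N
        (subst (t ≤_) (sym (popcount-pred-2^ N suc-b≡2^N)) t≤N) (≤-trans t≤N (≤-trans (m≤m+n N 2) N+2≤M))
        (≤-trans 2^N≤M (m≤m+n M t))
      s+reducible : ∀ i → Reducible (s i + (M * 2 ^ N + t))
      s+reducible i with N <? i
      ... | yes N<i = reducible-s+-large i N<i (PowSum⇒InP sum)
      ... | no  N≮i with i <? t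
      ...   | yes i<t with m≤n⇒∃[o]m+o≡n (1≤2^ i)
      ...     | b , suc-b≡2^i = reducible-s+-suc i (2^+≡suc i (2 ^ N) suc-b≡2^i) popcount≤t t≤2^N+b
        where
        b<2^N : b < 2 ^ N
        b<2^N = ≤-trans (≤-reflexive suc-b≡2^i) (^-monoʳ-≤ 2 (≮⇒≥ N≮i))
        popcount≤t : popcount (2 ^ N + b) ≤ t
        popcount≤t = subst (_≤ t) (sym (trans (popcount-2^+ N b<2^N) (cong suc (popcount-pred-2^ i suc-b≡2^i)))) i<t
        t≤2^N+b : t ≤ 2 ^ N + b
        t≤2^N+b = ≤-trans t≤N (≤-trans (<⇒≤ (n<2^n N)) (m≤m+n (2 ^ N) b))
      s+reducible i | no N≮i | no i≮t = reducible-s+-2+ (≮⇒≥ N≮i) (m≤m+n (2 ^ N) (2 ^ N)) (begin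
        t + M + 2                 ≡⟨ cong (λ m → t + m + 2) M≡ ⟩
        t + (2 ^ N + 2 ^ n) + 2   ≡⟨ regroup t (2 ^ N) (2 ^ n) ⟩
        (t + 2) + 2 ^ n + 2 ^ N   ≤⟨ +-monoˡ-≤ (2 ^ N) (+-monoˡ-≤ (2 ^ n) (≤-trans (+-monoˡ-≤ 2 t≤N) N+2≤2^n)) ⟩
        2 ^ n + 2 ^ n + 2 ^ N     ≡⟨ cong (_+ 2 ^ N) (2^-suc n) ⟨
        2 ^ suc n + 2 ^ N         ≤⟨ +-monoˡ-≤ (2 ^ N) (^-monoʳ-≤ 2 (≤-trans n<t (≮⇒≥ i≮t))) ⟩
        2 ^ i + 2 ^ N             ∎)
        where
        open ≤-Reasoning
        regroup : ∀ t X Y → t + (X + Y) + 2 ≡ (t + 2) + Y + X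
        regroup = solve-∀

    second-maximal : ∀ {t} → 4 ≤ t → t ≤ suc n → MaxAp n r (s 0) (M * (2 ^ N + 2 ^ n) + t)
    second-maximal {t} 4≤t t≤suc-n = maximal-criterion (PowSum⇒InP sum) irreducible s+reducible
      where
      t≤2^n : t ≤ 2 ^ n
      t≤2^n = ≤-trans t≤suc-n (n<2^n n)
      popcount-A : popcount (2 ^ N + 2 ^ n) ≡ 2
      popcount-A = trans (popcount-2^+ N 2^n<2^N) (cong suc (popcount-2^ n))
      sum : PowSum (2 ^ N + 2 ^ n) t
      sum = popcount≤⇒PowSum (subst (_≤ t) (sym popcount-A) (≤-trans (s≤s (s≤s z≤n)) 4≤t))
                             (≤-trans t≤2^n (m≤n+m (2 ^ n) (2 ^ N)))
      irreducible : ¬ Reducible (M * (2 ^ N + 2 ^ n) + t)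
      irreducible with m≤n⇒∃[o]m+o≡n (1≤2^ n)
      ... | b , suc-b≡2^n = irreducible-criterion (trans (sym (+-suc (2 ^ N) b)) (cong (2 ^ N +_) suc-b≡2^n))
        (subst (t ≤_) (sym (trans (popcount-2^+ N b<2^N) (cong suc (popcount-pred-2^ n suc-b≡2^n)))) t≤suc-n)
        (≤-trans t≤2^n 2^n≤M) (≤-trans (≤-reflexive (sym M≡)) (m≤m+n M t))
        where
        b<2^N : b < 2 ^ N
        b<2^N = ≤-trans (≤-reflexive suc-b≡2^n) (<⇒≤ 2^n<2^N)
      s+reducible : ∀ i → Reducible (s i + (M * (2 ^ N + 2 ^ n) + t))
      s+reducible i with N <? i
      ... | yes N<i = reducible-s+-large i N<i (PowSum⇒InP sum)
      ... | no  N≮i with 2 + i ≤? t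
      ...   | yes 2+i≤t with m≤n⇒∃[o]m+o≡n (1≤2^ i)
      ...     | b , suc-b≡2^i = reducible-s+-suc i (2^+≡suc i (2 ^ N + 2 ^ n) suc-b≡2^i) popcount≤t t≤A+b
        where
        b<2^n : b < 2 ^ n
        b<2^n = ≤-trans (≤-reflexive suc-b≡2^i) (^-monoʳ-≤ 2 (≤-trans (n≤1+n i) (≤-pred (≤-trans 2+i≤t t≤suc-n))))
        popcount≤t : popcount (2 ^ N + 2 ^ n + b) ≤ t
        popcount≤t = subst (_≤ t) (sym (trans (popcount-2^N+2^n+ b<2^n) (cong (2 +_) (popcount-pred-2^ i suc-b≡2^i)))) 2+i≤t
        t≤A+b : t ≤ 2 ^ N + 2 ^ n + b
        t≤A+b = ≤-trans t≤2^n (≤-trans (m≤n+m (2 ^ n) (2 ^ N)) (m≤m+n _ b))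
      s+reducible i | no N≮i | no 2+i≰t = reducible-s+-2+ (≮⇒≥ N≮i) (+-monoʳ-≤ (2 ^ N) (<⇒≤ 2^n<2^N)) (begin
        t + M + 2                 ≡⟨ regroup t M ⟩
        (t + 2) + M               ≤⟨ +-monoˡ-≤ M t+2≤2^i ⟩
        2 ^ i + M                 ≡⟨ cong (2 ^ i +_) M≡ ⟩
        2 ^ i + (2 ^ N + 2 ^ n)   ∎)
        where
        open ≤-Reasoning
        regroup : ∀ t M → t + M + 2 ≡ (t + 2) + M
        regroup = solve-∀
        t≤1+i : t ≤ suc i
        t≤1+i = ≤-pred (≰⇒> 2+i≰t)
        2<i : 2 < i
        2<i = ≤-pred (≤-trans 4≤t t≤1+i)
        t+2≤2^i : t + 2 ≤ 2 ^ i
        t+2≤2^i = begin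
          t + 2       ≤⟨ +-monoˡ-≤ 2 t≤1+i ⟩
          suc i + 2   ≡⟨ cong (_+ 2) (+-comm 1 i) ⟩
          i + 1 + 2   ≤⟨ +-monoˡ-≤ 2 (+-monoʳ-≤ i (≤-trans (s≤s z≤n) 2<i)) ⟩
          i + i + 2   ≤⟨ m+m+2≤2^m i 2<i ⟩
          2 ^ i       ∎

    third-maximal : MaxAp n r (s 0) (M * (2 ^ N + 2 ^ n + 4) + 4)
    third-maximal = maximal-criterion (PowSum⇒InP sum) irreducible s+reducible
      where
      X = 2 ^ N + 2 ^ n
      5<2^n : 5 < 2 ^ n
      5<2^n = ≤-trans (s≤s (s≤s (s≤s (s≤s (s≤s (s≤s z≤n)))))) 8≤2^n
      4<2^n : 4 < 2 ^ n
      4<2^n = <-trans (n<1+n 4) 5<2^n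
      3<2^n : 3 < 2 ^ n
      3<2^n = <-trans (n<1+n 3) 4<2^n
      sum : PowSum (X + 4) 4
      sum = popcount≤⇒PowSum (≤-trans (≤-reflexive (popcount-2^N+2^n+ 4<2^n)) (n≤1+n 3)) (m≤n+m 4 X)
      X+4≤2^N+2^N : X + 4 ≤ 2 ^ N + 2 ^ N
      X+4≤2^N+2^N = begin
        2 ^ N + 2 ^ n + 4     ≡⟨ +-assoc (2 ^ N) (2 ^ n) 4 ⟩
        2 ^ N + (2 ^ n + 4)   ≤⟨ +-monoʳ-≤ (2 ^ N) (≤-trans (+-monoʳ-≤ (2 ^ n) (<⇒≤ 4<2^n)) 2^n+2^n≤2^N) ⟩
        2 ^ N + 2 ^ N         ∎
        where open ≤-Reasoning
      irreducible : ¬ Reducible (M * (X + 4) + 4)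
      irreducible = irreducible-criterion (sym (+-suc X 3))
        (≤-reflexive (sym (popcount-2^N+2^n+ 3<2^n)))
        (≤-trans (<⇒≤ 4<2^n) 2^n≤M)
        (≤-reflexive (cong (_+ 4) (sym M≡)))
      s+reducible : ∀ i → Reducible (s i + (M * (X + 4) + 4))
      s+reducible i with N <? i
      s+reducible i             | yes N<i = reducible-s+-large i N<i (PowSum⇒InP sum)
      s+reducible zero          | no _    = reducible-s+-suc 0 refl (PowSum⇒popcount≤ sum) (PowSum⇒≤ sum)
      s+reducible (suc zero)    | no _    = reducible-s+-suc 1 (regroup X)
        (≤-reflexive (popcount-2^N+2^n+ 5<2^n)) (≤-trans (n≤1+n 4) (m≤n+m 5 X))
        where
        regroup : ∀ X → 2 + (X + 4) ≡ suc (X + 5)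
        regroup = solve-∀
      s+reducible (suc (suc j)) | no N≮i  = reducible-s+-2+ (≮⇒≥ N≮i) X+4≤2^N+2^N (begin
        4 + M + 2           ≡⟨ regroup M ⟩
        2 + (M + 4)         ≡⟨ cong (λ m → 2 + (m + 4)) M≡ ⟩
        2 + (X + 4)         ≤⟨ +-monoˡ-≤ (X + 4) (^-monoʳ-≤ 2 {1} {2 + j} (s≤s z≤n)) ⟩
        2 ^ (2 + j) + (X + 4) ∎)
        where
        open ≤-Reasoning
        regroup : ∀ M → 4 + M + 2 ≡ 2 + (M + 4)
        regroup = solve-∀

    Target⇒MaxAp : ∀ {A t} → Target A t → MaxAp n r (s 0) (M * A + t)
    Target⇒MaxAp (first n<t t≤N)      = first-maximal n<t t≤N
    Target⇒MaxAp (second 4≤t t≤suc-n) = second-maximal 4≤t t≤suc-n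
    Target⇒MaxAp third                = third-maximal

    -- An element of Ap(S, s 0) only involves the generators s 0, …, s N.
    irreducible⇒PowSum : ∀ {x} → InP n r x → ¬ Reducible x →
                         Σ ℕ λ a → Σ ℕ λ t → x ≡ M * a + t × PowSum a t × a ≤ t * 2 ^ N
    irreducible⇒PowSum P-zero _ = 0 , 0 , sym M*0+0≡0 , none , z≤n
    irreducible⇒PowSum (P-add e x∈) irr with N <? e
    ... | yes N<e = ⊥-elim (irr (reducible-+ʳ (reducible-s e N<e) x∈))
    ... | no  N≮e with irreducible⇒PowSum x∈ (λ x-red → irr (reducible-+ˡ (s∈ e) x-red))
    ... | a , t , refl , sum , a≤ = 2 ^ e + a , suc t , s+M*+≡ e a t , add e sum , +-mono-≤ (^-monoʳ-≤ 2 (≮⇒≥ N≮e)) a≤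

    large⇒reducible : ∀ {a t} → PowSum a t → M + t < a → a ≤ t * 2 ^ N → Reducible (M * a + t)
    large⇒reducible {zero}          _  ()      _
    large⇒reducible {suc zero}      _  (s≤s M+t≤0) _ =
      contradiction (≤-trans (m≤m+n M _) M+t≤0) (<⇒≱ (≤-trans (1≤2^ n) 2^n≤M))
    large⇒reducible {suc (suc a)} {zero}  () _ _
    large⇒reducible {suc (suc a)} {suc t} sum M+t<a a≤ = reducible-M*2+ (popcount≤⇒PowSum popcount≤ t+M≤a)
      where
      a<2^[t+N] : a < 2 ^ (suc t + N)
      a<2^[t+N] = begin-strict
        a                         <⟨ n≤1+n (suc a) ⟩
        suc (suc a)               ≤⟨ a≤ ⟩
        suc t * 2 ^ N             ≤⟨ *-monoˡ-≤ (2 ^ N) (<⇒≤ (n<2^n (suc t))) ⟩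
        2 ^ suc t * 2 ^ N         ≡⟨ ^-distribˡ-+-* 2 (suc t) N ⟨
        2 ^ (suc t + N)           ∎
        where open ≤-Reasoning
      popcount≤ : popcount a ≤ t + M
      popcount≤ = ≤-trans (popcount-<2^ (suc t + N) a<2^[t+N]) (begin
        suc t + N      ≡⟨ +-suc t N ⟨
        t + suc N      ≤⟨ +-monoʳ-≤ t (≤-trans (n≤1+n (suc N)) (subst (_≤ M) (+-comm N 2) N+2≤M)) ⟩
        t + M          ∎)
        where open ≤-Reasoning
      t+M≤a : t + M ≤ a
      t+M≤a = subst (_≤ a) (+-comm M t) (≤-pred (subst (_≤ suc a) (+-suc M t) (≤-pred M+t<a)))

    irreducible⇒≤M+ : ∀ {a t} → PowSum a t → ¬ Reducible (M * a + t) → a ≤ t * 2 ^ N → a ≤ M + t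
    irreducible⇒≤M+ {a} {t} sum irr a≤ with a ≤? M + t
    ... | yes a≤M+t = a≤M+t
    ... | no  a≰M+t = ⊥-elim (irr (large⇒reducible sum (≰⇒> a≰M+t) a≤))

    2^≤M+⇒≤N : ∀ t → 2 ^ t ≤ M + t → t ≤ N
    2^≤M+⇒≤N t 2^t≤M+t with t ≤? N
    ... | yes t≤N = t≤N
    ... | no  t≰N with m≤n⇒∃[o]m+o≡n (≰⇒> t≰N)
    ... | b , refl = contradiction 2^t≤M+t (<⇒≱ (begin-strict
      M + (suc N + b)              ≡⟨ cong (_+ (suc N + b)) M≡ ⟩
      2 ^ N + 2 ^ n + (suc N + b)  ≡⟨ regroup (2 ^ N) (2 ^ n) (suc N) b ⟩
      2 ^ N + (2 ^ n + suc N) + b  <⟨ +-monoˡ-< b (+-monoʳ-< (2 ^ N) 2^n+N<2^N) ⟩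
      2 ^ N + 2 ^ N + b            ≡⟨ cong (_+ b) (2^-suc N) ⟨
      2 ^ suc N + b                ≤⟨ 2^+≤2^[+] (suc N) b ⟩
      2 ^ (suc N + b)              ∎))
      where
      open ≤-Reasoning
      regroup : ∀ X Y S b → X + Y + (S + b) ≡ X + (Y + S) + b
      regroup = solve-∀
      2^n+N<2^N : 2 ^ n + suc N < 2 ^ N
      2^n+N<2^N = ≤-trans (≤-reflexive (sym (+-suc (2 ^ n) (suc N))))
                          (≤-trans (+-monoʳ-≤ (2 ^ n) (subst (_≤ 2 ^ n) (+-comm N 2) N+2≤2^n)) 2^n+2^n≤2^N)

    <popcount+ν₂⇒≤N : ∀ {a t} → 1 ≤ a → t < popcount a + ν₂ a → a ≤ M + t → t ≤ N
    <popcount+ν₂⇒≤N {a} {t} 1≤a t<P+v a≤M+t = 2^≤M+⇒≤N t (*-cancelˡ-≤ 2 (begin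
      2 * 2 ^ t                    ≤⟨ ^-monoʳ-≤ 2 t<P+v ⟩
      2 ^ (popcount a + ν₂ a)      ≤⟨ 2^popcount+ν₂≤ a 1≤a ⟩
      2 * a                        ≤⟨ *-monoʳ-≤ 2 a≤M+t ⟩
      2 * (M + t)                  ∎))
      where open ≤-Reasoning

    dominated-<2^N : ∀ {a d t} → 1 ≤ a → 1 ≤ d → a + d ≡ 2 ^ N →
                     popcount a ≤ t → t < popcount a + ν₂ a → Dominated a t
    dominated-<2^N 1≤a 1≤d a+d≡2^N P≤t t<P+v with complement-PowSum N 0 1≤a 1≤d a+d≡2^N P≤t t<P+v
    ... | _ , t+c≡N , sum = dominated (first n<N ≤-refl) sum a+d≡2^N t+c≡N

    dominated-2^N : ∀ {t} → t ≤ N → Dominated (2 ^ N) t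
    dominated-2^N {t} t≤N with t ≤? n
    ... | no  t≰n = dominated (first (≰⇒> t≰n) t≤N) none (+-identityʳ _) (+-identityʳ t)
    ... | yes t≤n = dominated (second 4≤suc-n ≤-refl) sum refl t+c≡
      where
      t+c≡ : t + (suc n ∸ t) ≡ suc n
      t+c≡ = m+[n∸m]≡n (≤-trans t≤n (n≤1+n n))
      sum : PowSum (2 ^ n) (suc n ∸ t)
      sum = popcount≤⇒PowSum (subst (_≤ suc n ∸ t) (sym (popcount-2^ n))
                                    (≤-trans (≤-reflexive (sym (m+n∸n≡m 1 n))) (∸-monoʳ-≤ (suc n) t≤n)))
                             (≤-trans (m∸n≤m (suc n) t) (n<2^n n))

    dominated-2^N+<2^n : ∀ {a d t} → 1 ≤ a → 1 ≤ d → a + d ≡ 2 ^ n →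
                         1 + popcount a ≤ t → t < 1 + popcount a + ν₂ a → Dominated (2 ^ N + a) t
    dominated-2^N+<2^n {a} {d} 1≤a 1≤d a+d≡2^n P≤t t<P+v with complement-PowSum n 1 1≤a 1≤d a+d≡2^n P≤t t<P+v
    ... | _ , t+c≡suc-n , sum =
      dominated (second 4≤suc-n ≤-refl) sum (trans (+-assoc (2 ^ N) a d) (cong (2 ^ N +_) a+d≡2^n)) t+c≡suc-n

    dominated-2^N+2^n : ∀ {t} → t ≤ suc n → Dominated (2 ^ N + 2 ^ n) t
    dominated-2^N+2^n {t} t≤suc-n with 4 ≤? t
    ... | yes 4≤t = dominated (second 4≤t t≤suc-n) none (+-identityʳ _) (+-identityʳ t)
    ... | no  4≰t = dominated third sum refl t+c≡4
      where
      t+c≡4 : t + (4 ∸ t) ≡ 4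
      t+c≡4 = m+[n∸m]≡n (≤-trans (≤-pred (≰⇒> 4≰t)) (n≤1+n 3))
      sum : PowSum 4 (4 ∸ t)
      sum = popcount≤⇒PowSum (∸-monoʳ-≤ 4 (≤-pred (≰⇒> 4≰t))) (m∸n≤m 4 t)

    dominated-2^N+2^n+ : ∀ {δ t} → 1 ≤ δ → δ ≤ t →
                         2 + popcount δ ≤ t → t < 2 + popcount δ + ν₂ δ → Dominated (2 ^ N + (2 ^ n + δ)) t
    dominated-2^N+2^n+ {δ} {t} 1≤δ δ≤t P≤t t<P+v =
      small δ (≤1+popcount+ν₂⇒≤4 1≤δ (≤-trans δ≤t (≤-pred t<P+v))) δ≤t P≤t t<P+v
      where
      small : ∀ δ → δ ≤ 4 → δ ≤ t → 2 + popcount δ ≤ t → t < 2 + popcount δ + ν₂ δ →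
              Dominated (2 ^ N + (2 ^ n + δ)) t
      small 0 _ _ 2≤t t<2 = contradiction t<2 (≤⇒≯ 2≤t)
      small 1 _ _ 3≤t t<3 = contradiction t<3 (≤⇒≯ 3≤t)
      small 2 _ _ 3≤t t<4 = dominated third (add 1 none) (regroup (2 ^ N) (2 ^ n)) (cong (_+ 1) (≤-antisym (≤-pred t<4) 3≤t))
        where
        regroup : ∀ X Y → X + (Y + 2) + (2 + 0) ≡ X + Y + 4
        regroup = solve-∀
      small 3 _ _ 4≤t t<4 = contradiction t<4 (≤⇒≯ 4≤t)
      small 4 _ 4≤t _ t<5 = dominated third none (regroup (2 ^ N) (2 ^ n)) (trans (+-identityʳ t) (≤-antisym (≤-pred t<5) 4≤t))
        where
        regroup : ∀ X Y → X + (Y + 4) + 0 ≡ X + Y + 4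
        regroup = solve-∀
      small (suc (suc (suc (suc (suc _))))) (s≤s (s≤s (s≤s (s≤s ())))) _ _ _

    dominated-2^N+ : ∀ {a t} → 1 ≤ a → a ≤ 2 ^ n + t → t ≤ N →
                     1 + popcount a ≤ t → t < 1 + popcount a + ν₂ a → Dominated (2 ^ N + a) t
    dominated-2^N+ {a} {t} 1≤a a≤2^n+t t≤N P≤t t<P+v with a ≤? 2 ^ n
    ... | yes a≤2^n with m≤n⇒∃[o]m+o≡n a≤2^n
    ...   | zero  , a+0≡2^n rewrite +-identityʳ a | a+0≡2^n =
      dominated-2^N+2^n (≤-pred (subst (t <_) (cong₂ (λ p v → 1 + p + v) (popcount-2^ n) (ν₂-2^ n)) t<P+v))
    ...   | suc _ , a+d≡2^n = dominated-2^N+<2^n 1≤a (s≤s z≤n) a+d≡2^n P≤t t<P+v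
    dominated-2^N+ {a} {t} 1≤a a≤2^n+t t≤N P≤t t<P+v | no a≰2^n with m≤n⇒∃[o]m+o≡n (≰⇒> a≰2^n)
    ... | k , 2^n+1+k≡a = subst (λ a → Dominated (2 ^ N + a) t) a≡ (dominated-2^N+2^n+ (s≤s z≤n) δ≤t
        (subst (_≤ t) (cong suc P≡) P≤t) (subst (t <_) (cong₂ (λ p v → 1 + p + v) P≡ v≡) t<P+v))
      where
      a≡ : 2 ^ n + suc k ≡ a
      a≡ = trans (+-suc (2 ^ n) k) 2^n+1+k≡a
      δ≤t : suc k ≤ t
      δ≤t = +-cancelˡ-≤ (2 ^ n) (suc k) t (subst (_≤ 2 ^ n + t) (sym a≡) a≤2^n+t)
      δ<2^n : suc k < 2 ^ n
      δ<2^n = ≤-<-trans (≤-trans δ≤t t≤N) N<2^n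
      P≡ : popcount a ≡ 1 + popcount (suc k)
      P≡ = trans (cong popcount (sym a≡)) (popcount-2^+ n δ<2^n)
      v≡ : ν₂ a ≡ ν₂ (suc k)
      v≡ = trans (cong ν₂ (sym a≡)) (ν₂-2^+ n (s≤s z≤n) δ<2^n)

    bounded⇒Dominated : ∀ {a t} → 1 ≤ a → popcount a ≤ t → t < popcount a + ν₂ a → a ≤ M + t → Dominated a t
    bounded⇒Dominated {a} {t} 1≤a P≤t t<P+v a≤M+t with a ≤? 2 ^ N
    ... | yes a≤2^N with m≤n⇒∃[o]m+o≡n a≤2^N
    ...   | zero  , a+0≡2^N rewrite +-identityʳ a | a+0≡2^N =
      dominated-2^N (<popcount+ν₂⇒≤N 1≤a t<P+v a≤M+t)
    ...   | suc _ , a+d≡2^N = dominated-<2^N 1≤a (s≤s z≤n) a+d≡2^N P≤t t<P+v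
    bounded⇒Dominated {a} {t} 1≤a P≤t t<P+v a≤M+t | no a≰2^N with m≤n⇒∃[o]m+o≡n (≰⇒> a≰2^N)
    ... | k , 2^N+1+k≡a = subst (λ a → Dominated a t) a≡ (dominated-2^N+ (s≤s z≤n) a''≤2^n+t t≤N
        (subst (_≤ t) P≡ P≤t) (subst (t <_) (cong₂ _+_ P≡ v≡) t<P+v))
      where
      t≤N = <popcount+ν₂⇒≤N 1≤a t<P+v a≤M+t
      a≡ : 2 ^ N + suc k ≡ a
      a≡ = trans (+-suc (2 ^ N) k) 2^N+1+k≡a
      a''≤2^n+t : suc k ≤ 2 ^ n + t
      a''≤2^n+t = +-cancelˡ-≤ (2 ^ N) (suc k) (2 ^ n + t) (begin
        2 ^ N + suc k       ≡⟨ a≡ ⟩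
        a                   ≤⟨ a≤M+t ⟩
        M + t               ≡⟨ cong (_+ t) M≡ ⟩
        2 ^ N + 2 ^ n + t   ≡⟨ +-assoc (2 ^ N) (2 ^ n) t ⟩
        2 ^ N + (2 ^ n + t) ∎)
        where open ≤-Reasoning
      a''<2^N : suc k < 2 ^ N
      a''<2^N = begin-strict
        suc k           ≤⟨ a''≤2^n+t ⟩
        2 ^ n + t       <⟨ +-monoʳ-< (2 ^ n) (≤-<-trans t≤N N<2^n) ⟩
        2 ^ n + 2 ^ n   ≤⟨ 2^n+2^n≤2^N ⟩
        2 ^ N           ∎
        where open ≤-Reasoning
      P≡ : popcount a ≡ 1 + popcount (suc k)
      P≡ = trans (cong popcount (sym a≡)) (popcount-2^+ N a''<2^N)
      v≡ : ν₂ a ≡ ν₂ (suc k)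
      v≡ = trans (cong ν₂ (sym a≡)) (ν₂-2^+ N (s≤s z≤n) a''<2^N)

    irreducible⇒Dominated : ∀ {a t} → PowSum a t → 1 ≤ a → ¬ Reducible (M * a + t) → a ≤ t * 2 ^ N → Dominated a t
    irreducible⇒Dominated sum 1≤a irr a≤ =
      bounded⇒Dominated 1≤a (PowSum⇒popcount≤ sum) (irreducible⇒<popcount+ν₂ sum 1≤a irr) (irreducible⇒≤M+ sum irr a≤)

    Ap⇒≤Target : ∀ {x} → InAp n r (s 0) x → Σ ℕ λ A → Σ ℕ λ u → Target A u × x ≤[ n , r ] (M * A + u)
    Ap⇒≤Target (x∈ , irr) with irreducible⇒PowSum x∈ irr
    ... | zero , t , refl , sum , _ with PowSum⇒≤ sum
    ...   | z≤n = _ , _ , third , _ , proj₁ (proj₁ third-maximal) , cong (_+ (M * (2 ^ N + 2 ^ n + 4) + 4)) M*0+0≡0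
    Ap⇒≤Target (x∈ , irr) | suc a , t , refl , sum , a≤ with irreducible⇒Dominated sum (s≤s z≤n) irr a≤
    ... | dominated {b = b} {c = c} target gap refl refl =
      _ , _ , target , M * b + c , PowSum⇒InP gap , regroup M (suc a) t b c
      where
      regroup : ∀ M a t b c → M * a + t + (M * b + c) ≡ M * (a + b) + (t + c)
      regroup = solve-∀

    MaxAp⇒InTarget : ∀ {x} → MaxAp n r (s 0) x → InTarget n r x
    MaxAp⇒InTarget (x∈Ap , maximal) with Ap⇒≤Target x∈Ap
    ... | _ , _ , target , x≤T = subst (InTarget n r) (maximal _ (proj₁ (Target⇒MaxAp target)) x≤T) (Target⇒InTarget target)

    InTarget⇒MaxAp : ∀ {x} → InTarget n r x → MaxAp n r (s 0) x
    InTarget⇒MaxAp x∈T with InTarget⇒Target x∈T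
    ... | _ , _ , target , refl = Target⇒MaxAp target

theorem7 : (n r : ℕ) → 2 < n → 1 ≤ r → 2 ^ r + 1 < 2 ^ n →
    (x : ℕ) → (MaxAp n r (gen n r 0) x → InTarget n r x) × (InTarget n r x → MaxAp n r (gen n r 0) x)
theorem7 n r 2<n 1≤r 2^r+1<2^n x = MaxAp⇒InTarget , InTarget⇒MaxAp
  where open Semigroup.Bounded n r 2<n 1≤r 2^r+1<2^n
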